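{- The domination number is stable under 2-switch: for every graph $G$ and every 2-switch $\tau$, $|\gamma(\tau(G))-\gamma(G)|\le 1$.
   Context: Graphs are finite, simple, undirected and labeled. $\gamma(G)$ is the minimum cardinality of a set $D$ of vertices such that every vertex not in $D$ is adjacent to some vertex of $D$. For vertices $a,b,c,d$, the 2-switch $\tau=\binom{a\ b}{c\ d}$ maps $G$ to $G-ab-cd+ac+bd$ if $ab,cd\in E(G)$, $\{a,b\}\cap\{c,d\}=\varnothing$ and $ac,bd\notin E(G)$, and to $G$ otherwise. -}

module Defs where

open import Data.Nat using (ℕ; _≤_; _+_)
open import Data.Fin using (Fin; _≟_)
open import Data.Fin.Subset using (Subset; _∈_; ∣_∣)
open import Data.Bool using (Bool; true; false; _∧_; _∨_; not; if_then_else_)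
open import Data.Product using (Σ; ∃; _×_; _,_)
open import Data.Sum using (_⊎_)
open import Relation.Nullary using (¬_)
open import Relation.Nullary.Decidable using (⌊_⌋)
open import Relation.Binary.PropositionalEquality using (_≡_)

Graph : ℕ → Set
Graph n = Fin n → Fin n → Bool

IsSimple : ∀ {n} → Graph n → Set
IsSimple {n} G = (∀ (u v : Fin n) → G u v ≡ G v u) × (∀ (v : Fin n) → G v v ≡ false)

_==_ : ∀ {n} → Fin n → Fin n → Bool
x == y = ⌊ x ≟ y ⌋

samePair : ∀ {n} → Fin n → Fin n → Fin n → Fin n → Bool
samePair x y a b = ((x == a) ∧ (y == b)) ∨ ((x == b) ∧ (y == a))

applicable : ∀ {n} → Graph n → Fin n → Fin n → Fin n → Fin n → Bool
applicable G a b c d =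
  G a b ∧ G c d ∧ not (G a c) ∧ not (G b d)
  ∧ not (a == c) ∧ not (a == d) ∧ not (b == c) ∧ not (b == d)

switchEdges : ∀ {n} → Graph n → Fin n → Fin n → Fin n → Fin n → Graph n
switchEdges G a b c d x y =
  if samePair x y a b ∨ samePair x y c d then false
  else if samePair x y a c ∨ samePair x y b d then true
  else G x y

twoSwitch : ∀ {n} → Fin n → Fin n → Fin n → Fin n → Graph n → Graph n
twoSwitch a b c d G =
  if applicable G a b c d then switchEdges G a b c d else G

IsDominating : ∀ {n} → Graph n → Subset n → Set
IsDominating {n} G D = ∀ (v : Fin n) → ¬ (v ∈ D) → ∃ λ (u : Fin n) → u ∈ D × G u v ≡ true

IsDominationNumber : ∀ {n} → Graph n → ℕ → Set
IsDominationNumber G k =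
  (∃ λ D → IsDominating G D × ∣ D ∣ ≡ k) × (∀ D → IsDominating G D → k ≤ ∣ D ∣)

module Submission where

-- A 2-switch (a b / c d) deletes the edges ab, cd and adds ac, bd; on the switched graph the
-- 2-switch (a c / b d) undoes it.  Both directions are instances of one situation: H arises from
-- G by deleting two edges pq, rs, and pr, qs are edges of H.  Take a dominating set D of G.  Only
-- an endpoint of a deleted edge whose other endpoint lies in D can lose its dominator, and every
-- deleted edge joins {p, r} to {q, s}.  Since pr and qs are edges of H, a vertex of either pair
-- dominates that whole pair in H.  So D ∪ {q} dominates H if D meets {p, r}, and D ∪ {p} does
-- otherwise; hence γ(H) ≤ γ(G) + 1.

open import Defs
open import Data.Bool using (true; false; T; _∧_; _∨_)
open import Data.Bool.Properties using (T-≡; T-∧; T-∨; ∨-comm; ∧-comm; ∨-zeroʳ)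
open import Data.Fin using (Fin; zero; suc; _≟_)
open import Data.Fin.Subset using (Subset; _∈_; _⊆_; ∣_∣; _∪_; ⁅_⁆; inside; outside)
open import Data.Fin.Subset.Properties using (_∈?_; p⊆p∪q; x∈p∪q⁺; x∈⁅x⁆; ∪-identityʳ)
open import Data.Nat using (ℕ; _≤_; _+_; s≤s)
open import Data.Nat.Properties using (≤-reflexive; ≤-trans; m≤m+n; +-comm)
open import Data.Product using (_×_; _,_; ∃)
import Data.Product as Product
open import Data.Sum using (_⊎_; inj₁; inj₂; swap)
import Data.Sum as Sum
open import Data.Vec using (_∷_)
open import Function using (_∘_; Equivalence)
open import Relation.Nullary using (yes; no; contradiction)
open import Relation.Nullary.Decidable using (toWitness; _⊎-dec_)
open import Relation.Binary.PropositionalEquality using (_≡_; _≢_; refl; trans; cong₂; ≢-sym)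

open Equivalence using (to; from)

∣p∪⁅x⁆∣≤∣p∣+1 : ∀ {n} (p : Subset n) (x : Fin n) → ∣ p ∪ ⁅ x ⁆ ∣ ≤ ∣ p ∣ + 1
∣p∪⁅x⁆∣≤∣p∣+1 (inside  ∷ p) zero    rewrite ∪-identityʳ p = m≤m+n _ 1
∣p∪⁅x⁆∣≤∣p∣+1 (outside ∷ p) zero    rewrite ∪-identityʳ p = ≤-reflexive (+-comm 1 ∣ p ∣)
∣p∪⁅x⁆∣≤∣p∣+1 (inside  ∷ p) (suc x) = s≤s (∣p∪⁅x⁆∣≤∣p∣+1 p x)
∣p∪⁅x⁆∣≤∣p∣+1 (outside ∷ p) (suc x) = ∣p∪⁅x⁆∣≤∣p∣+1 p x

DominationGrowsByAtMostOne : ∀ {n} → Graph n → Graph n → Set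
DominationGrowsByAtMostOne G H =
  ∀ {D} → IsDominating G D → ∃ λ S → IsDominating H S × ∣ S ∣ ≤ ∣ D ∣ + 1

domination-grows-refl : ∀ {n} {G : Graph n} → DominationGrowsByAtMostOne G G
domination-grows-refl D-dom = _ , D-dom , m≤m+n _ 1

domination-number-≤+1 : ∀ {n} {G H : Graph n} → DominationGrowsByAtMostOne G H
                      → ∀ {k k′} → IsDominationNumber G k → IsDominationNumber H k′ → k′ ≤ k + 1
domination-number-≤+1 grows ((D , D-dom , refl) , _) (_ , H-min) with grows D-dom
... | S , S-dom , ∣S∣≤∣D∣+1 = ≤-trans (H-min S S-dom) ∣S∣≤∣D∣+1

Covered : ∀ {n} → Graph n → Subset n → Fin n → Set
Covered H S v = v ∈ S ⊎ ∃ λ w → w ∈ S × H w v ≡ true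

covered-by-edge : ∀ {n} (H : Graph n) {S x y} → H x y ≡ true → x ∈ S ⊎ y ∈ S → Covered H S y
covered-by-edge H Hxy (inj₁ x∈S) = inj₂ (_ , x∈S , Hxy)
covered-by-edge H Hxy (inj₂ y∈S) = inj₁ y∈S

dominating-extend : ∀ {n} {G H : Graph n} {Lost : Fin n → Fin n → Set} {D S}
                  → (∀ u v → G u v ≡ true → H u v ≡ true ⊎ Lost u v)
                  → (∀ {u v} → Lost u v → u ∈ D → Covered H S v)
                  → D ⊆ S → IsDominating G D → IsDominating H S
dominating-extend G⊆H∪Lost lost-covered D⊆S D-dom v v∉S with D-dom v (v∉S ∘ D⊆S)
... | u , u∈D , Guv with G⊆H∪Lost u v Guv
...   | inj₁ Huv = u , D⊆S u∈D , Huv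
...   | inj₂ lost with lost-covered lost u∈D
...     | inj₁ v∈S       = contradiction v∈S v∉S
...     | inj₂ neighbour = neighbour

x∈p∪⁅x⁆ : ∀ {n} (p : Subset n) (x : Fin n) → x ∈ p ∪ ⁅ x ⁆
x∈p∪⁅x⁆ p x = x∈p∪q⁺ (inj₂ (x∈⁅x⁆ x))

SamePair : ∀ {n} → Fin n → Fin n → Fin n → Fin n → Set
SamePair x y a b = (x ≡ a × y ≡ b) ⊎ (x ≡ b × y ≡ a)

module EdgeRewiring {n} (G H : Graph n) (p q r s : Fin n)
  (H-sym : ∀ u v → H u v ≡ H v u) (H-pr : H p r ≡ true) (H-qs : H q s ≡ true)
  (G⊆H∪pq,rs : ∀ u v → G u v ≡ true → H u v ≡ true ⊎ (SamePair u v p q ⊎ SamePair u v r s))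
  where

  Repairs : Subset n → Subset n → Set
  Repairs D S = (p ∈ D ⊎ r ∈ D → q ∈ S ⊎ s ∈ S) × (q ∈ D ⊎ s ∈ D → p ∈ S ⊎ r ∈ S)

  repairs⇒covered : ∀ {D S u v} → Repairs D S → SamePair u v p q ⊎ SamePair u v r s → u ∈ D
                  → Covered H S v
  repairs⇒covered (pr→qs , _) (inj₁ (inj₁ (refl , refl))) u∈D =
    covered-by-edge H (trans (H-sym s q) H-qs) (swap (pr→qs (inj₁ u∈D)))
  repairs⇒covered (_ , qs→pr) (inj₁ (inj₂ (refl , refl))) u∈D =
    covered-by-edge H (trans (H-sym r p) H-pr) (swap (qs→pr (inj₁ u∈D)))
  repairs⇒covered (pr→qs , _) (inj₂ (inj₁ (refl , refl))) u∈D =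
    covered-by-edge H H-qs (pr→qs (inj₂ u∈D))
  repairs⇒covered (_ , qs→pr) (inj₂ (inj₂ (refl , refl))) u∈D =
    covered-by-edge H H-pr (qs→pr (inj₂ u∈D))

  repair : ∀ D → ∃ λ x → Repairs D (D ∪ ⁅ x ⁆)
  repair D with p ∈? D ⊎-dec r ∈? D
  ... | yes pr∩D = q , (λ _ → inj₁ (x∈p∪⁅x⁆ D q)) , (λ _ → Sum.map (p⊆p∪q _) (p⊆p∪q _) pr∩D)
  ... | no ¬pr∩D = p , (λ pr∩D → contradiction pr∩D ¬pr∩D) , (λ _ → inj₁ (x∈p∪⁅x⁆ D p))

  domination-grows : DominationGrowsByAtMostOne G H
  domination-grows {D} D-dom with repair D
  ... | x , repairs =
    D ∪ ⁅ x ⁆ ,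
    dominating-extend G⊆H∪pq,rs (repairs⇒covered repairs) (p⊆p∪q ⁅ x ⁆) D-dom ,
    ∣p∪⁅x⁆∣≤∣p∣+1 D x

==-∧-sound : ∀ {n} (x a y b : Fin n) → T ((x == a) ∧ (y == b)) → x ≡ a × y ≡ b
==-∧-sound x a y b = Product.map (toWitness {a? = x ≟ a}) (toWitness {a? = y ≟ b}) ∘ to (T-∧ {x == a})

samePair-sound : ∀ {n} {x y a b : Fin n} → samePair x y a b ≡ true → SamePair x y a b
samePair-sound {x = x} {y} {a} {b} =
  Sum.map (==-∧-sound x a y b) (==-∧-sound x b y a) ∘ to (T-∨ {(x == a) ∧ (y == b)}) ∘ from T-≡

samePair-sym : ∀ {n} (x y a b : Fin n) → samePair x y a b ≡ samePair y x a b
samePair-sym x y a b =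
  trans (∨-comm ((x == a) ∧ (y == b)) _) (cong₂ _∨_ (∧-comm (x == b) (y == a)) (∧-comm (x == a) (y == b)))

samePair-refl : ∀ {n} (a b : Fin n) → samePair a b a b ≡ true
samePair-refl a b with a ≟ a | b ≟ b
... | yes _   | yes _   = refl
... | no a≢a  | _       = contradiction refl a≢a
... | yes _   | no b≢b  = contradiction refl b≢b

samePair-≢ˡ : ∀ {n} {x y a b : Fin n} → x ≢ a → x ≢ b → samePair x y a b ≡ false
samePair-≢ˡ {x = x} {a = a} {b} x≢a x≢b with x ≟ a | x ≟ b
... | yes x≡a | _       = contradiction x≡a x≢a
... | no _    | yes x≡b = contradiction x≡b x≢b
... | no _    | no _    = refl

samePair-≢ʳ : ∀ {n} {x y a b : Fin n} → y ≢ a → y ≢ b → samePair x y a b ≡ false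
samePair-≢ʳ {x = x} {y} {a} {b} y≢a y≢b = trans (samePair-sym x y a b) (samePair-≢ˡ y≢a y≢b)

applicable-sound : ∀ {n} {G : Graph n} {a b c d} → applicable G a b c d ≡ true
                 → G a b ≡ true × G c d ≡ true × a ≢ c × a ≢ d × b ≢ c × b ≢ d
applicable-sound {G = G} {a} {b} {c} {d} app
  with G a b | G c d | G a c | G b d | a ≟ c | a ≟ d | b ≟ c | b ≟ d | app
... | true  | true  | false | false | no a≢c | no a≢d | no b≢c | no b≢d | _ =
  refl , refl , a≢c , a≢d , b≢c , b≢d
... | false | _     | _     | _     | _      | _      | _      | _      | ()
... | true  | false | _     | _     | _      | _      | _      | _      | ()
... | true  | true  | true  | _     | _      | _      | _      | _      | ()
... | true  | true  | false | true  | _      | _      | _      | _      | ()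
... | true  | true  | false | false | yes _  | _      | _      | _      | ()
... | true  | true  | false | false | no _   | yes _  | _      | _      | ()
... | true  | true  | false | false | no _   | no _   | yes _  | _      | ()
... | true  | true  | false | false | no _   | no _   | no _   | yes _  | ()

module _ {n} (G : Graph n) (a b c d : Fin n) where

  switchEdges-sym : (∀ u v → G u v ≡ G v u)
                  → ∀ u v → switchEdges G a b c d u v ≡ switchEdges G a b c d v u
  switchEdges-sym G-sym u v
    rewrite samePair-sym u v a b | samePair-sym u v c d | samePair-sym u v a c | samePair-sym u v b d
          | G-sym u v
    = refl

  switchEdges-ac : a ≢ c → a ≢ d → b ≢ c → switchEdges G a b c d a c ≡ true
  switchEdges-ac a≢c a≢d b≢c
    rewrite samePair-≢ʳ {x = a} (≢-sym a≢c) (≢-sym b≢c) | samePair-≢ˡ {y = c} a≢c a≢d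
          | samePair-refl a c
    = refl

  switchEdges-bd : a ≢ d → b ≢ c → b ≢ d → switchEdges G a b c d b d ≡ true
  switchEdges-bd a≢d b≢c b≢d
    rewrite samePair-≢ʳ {x = b} (≢-sym a≢d) (≢-sym b≢d) | samePair-≢ˡ {y = d} b≢c b≢d
          | samePair-refl b d | ∨-zeroʳ (samePair b d a c)
    = refl

  switchEdges-removed : ∀ u v → G u v ≡ true
                      → switchEdges G a b c d u v ≡ true ⊎ (SamePair u v a b ⊎ SamePair u v c d)
  switchEdges-removed u v Guv with samePair u v a b in ab | samePair u v c d in cd
  ... | true  | _    = inj₂ (inj₁ (samePair-sound ab))
  ... | false | true = inj₂ (inj₂ (samePair-sound cd))
  ... | false | false with samePair u v a c ∨ samePair u v b d
  ...   | true  = inj₁ refl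
  ...   | false = inj₁ Guv

  switchEdges-added : ∀ u v → switchEdges G a b c d u v ≡ true
                    → G u v ≡ true ⊎ (SamePair u v a c ⊎ SamePair u v b d)
  switchEdges-added u v τGuv with samePair u v a b ∨ samePair u v c d
  switchEdges-added u v () | true
  ... | false with samePair u v a c in ac | samePair u v b d in bd
  ...   | true  | _     = inj₂ (inj₁ (samePair-sound ac))
  ...   | false | true  = inj₂ (inj₂ (samePair-sound bd))
  ...   | false | false = inj₁ τGuv

lemma8 : ∀ {n} (G : Graph n) → IsSimple G → (a b c d : Fin n) (k k′ : ℕ)
       → IsDominationNumber G k → IsDominationNumber (twoSwitch a b c d G) k′
       → k′ ≤ k + 1 × k ≤ k′ + 1
lemma8 G (G-sym , _) a b c d k k′ γG γτG with applicable G a b c d in app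
... | false = domination-number-≤+1 domination-grows-refl γG γτG
            , domination-number-≤+1 domination-grows-refl γτG γG
... | true with applicable-sound app
...   | Gab , Gcd , a≢c , a≢d , b≢c , b≢d =
  domination-number-≤+1 switch γG γτG , domination-number-≤+1 unswitch γτG γG
  where
    τG : Graph _
    τG = switchEdges G a b c d

    switch : DominationGrowsByAtMostOne G τG
    switch = EdgeRewiring.domination-grows G τG a b c d (switchEdges-sym G a b c d G-sym)
               (switchEdges-ac G a b c d a≢c a≢d b≢c) (switchEdges-bd G a b c d a≢d b≢c b≢d)
               (switchEdges-removed G a b c d)

    unswitch : DominationGrowsByAtMostOne τG G
    unswitch = EdgeRewiring.domination-grows τG G a c b d G-sym Gab Gcd (switchEdges-added G a b c d)
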